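{- Let $k\ge1$, $\pi\in S_k$, and let $p=(\pi,R)$ be the boxed pattern with $R=[1,k-1]\times[1,k-1]$ (everything shaded except the first and last rows and the first and last columns of boxes). Then \[ \liminf_{n\to\infty}\frac{s_n^+(p)}{n!}\ge\frac1{k!}. \]
   Context: For $n\ge1$, $S_n$ is the set of permutations of $\{1,\dots,n\}$ in one-line notation $\tau=\tau_1\cdots\tau_n$. For integers $k\ge0$ write $[k]=\{0,1,\dots,k\}$ and $[a,b]=\{a,a+1,\dots,b\}$. A mesh pattern of length $k$ is a pair $(\pi,R)$ with $\pi\in S_k$ and $R\subseteq[k]\times[k]$; the elements $(x,y)\in R$ are the shaded boxes (box $(x,y)$ is the unit square with south-west corner $(x,y)$ in the plot of the points $(i,\pi_i)$). An occurrence of $(\pi,R)$ in $\tau\in S_n$ is a choice of positions $i_1<\dots<i_k$ such that $\tau_{i_a}<\tau_{i_b}$ iff $\pi_a<\pi_b$ for all $a,b$, and such that for every $(x,y)\in R$ there is no index $m$ with $i_x<m<i_{x+1}$ and $v_y<\tau_m<v_{y+1}$, where $i_0=0$, $i_{k+1}=n+1$, $v_0=0$, $v_{k+1}=n+1$, and for $1\le y\le k$, $v_y$ is the $y$-th smallest of the values $\tau_{i_1},\dots,\tau_{i_k}$. A permutation contains a mesh pattern if it has at least one occurrence of it, and $s_n^+(p)$ denotes the number of permutations in $S_n$ containing $p$. -}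

module Defs where

open import Data.Nat using (ℕ; zero; suc; _+_; _∸_; _≡ᵇ_; _<ᵇ_; _≤ᵇ_)
open import Data.Bool using (Bool; true; false; not; _∧_; _∨_; if_then_else_; T)
open import Data.List using (List; []; _∷_; [_]; map; concatMap; upTo; length; filter)
open import Data.Bool.ListAction using (all; any)
open import Relation.Nullary.Decidable using (T?)

-- Conventions: permutations, patterns and position lists are lists of
-- natural numbers; permutations of {1,…,n} in one-line notation, positions
-- and values are 1-based as in the paper.

range : ℕ → ℕ → List ℕ
range a b = map (a +_) (upTo (suc b ∸ a))

words : ℕ → ℕ → List (List ℕ)
words zero    n = [ [] ]
words (suc l) n = concatMap (λ w → map (_∷ w) (range 1 n)) (words l n)

distinct : List ℕ → Bool
distinct []       = true
distinct (x ∷ xs) = not (any (x ≡ᵇ_) xs) ∧ distinct xs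

isPerm : ℕ → List ℕ → Bool
isPerm n w = (length w ≡ᵇ n) ∧ (all (λ x → (1 ≤ᵇ x) ∧ (x ≤ᵇ n)) w ∧ distinct w)

perms : ℕ → List (List ℕ)
perms n = filter (λ w → T? (isPerm n w)) (words n n)

incSeqs : ℕ → ℕ → ℕ → List (List ℕ)
incSeqs zero    lo hi = [ [] ]
incSeqs (suc k) lo hi = concatMap (λ i → map (i ∷_) (incSeqs k (suc i) hi)) (range lo hi)

-- 1-based lookup (junk value 0 outside the range)
at : List ℕ → ℕ → ℕ
at []       _             = 0
at (x ∷ xs) zero          = 0
at (x ∷ xs) (suc zero)    = x
at (x ∷ xs) (suc (suc i)) = at xs (suc i)

insert : ℕ → List ℕ → List ℕ
insert x []       = [ x ]
insert x (y ∷ ys) = if x ≤ᵇ y then x ∷ y ∷ ys else y ∷ insert x ys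

isort : List ℕ → List ℕ
isort []       = []
isort (x ∷ xs) = insert x (isort xs)

_⇔ᵇ_ : Bool → Bool → Bool
b ⇔ᵇ c = (b ∧ c) ∨ (not b ∧ not c)

allPairs : List ℕ → List ℕ → (ℕ → ℕ → Bool) → Bool
allPairs xs ys f = all (λ x → all (λ y → f x y) ys) xs

-- A mesh pattern of length k: pattern π (a list) and shaded set R given as
-- a boolean predicate on boxes (x,y); only boxes in [k]×[k] are consulted.

isOccurrence : (k : ℕ) → List ℕ → (ℕ → ℕ → Bool) → (n : ℕ) → List ℕ → List ℕ → Bool
isOccurrence k π R n τ is = orderOK ∧ boxOK
  where
  -- i_0 = 0, i_{k+1} = n+1
  ipos : ℕ → ℕ
  ipos x = if x ≡ᵇ 0 then 0 else (if k <ᵇ x then suc n else at is x)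
  -- v_1 < … < v_k are the values τ_{i_1},…,τ_{i_k} sorted; v_0 = 0, v_{k+1} = n+1
  vs : List ℕ
  vs = isort (map (at τ) is)
  v : ℕ → ℕ
  v y = if y ≡ᵇ 0 then 0 else (if k <ᵇ y then suc n else at vs y)
  orderOK : Bool
  orderOK = allPairs (range 1 k) (range 1 k)
              (λ a b → (at τ (at is a) <ᵇ at τ (at is b)) ⇔ᵇ (at π a <ᵇ at π b))
  boxOK : Bool
  boxOK = allPairs (range 0 k) (range 0 k)
            (λ x y → not (R x y) ∨
               not (any (λ m → ((ipos x <ᵇ m) ∧ (m <ᵇ ipos (suc x)))
                              ∧ ((v y <ᵇ at τ m) ∧ (at τ m <ᵇ v (suc y))))
                        (range 1 n)))

contains : (k : ℕ) → List ℕ → (ℕ → ℕ → Bool) → List ℕ → Bool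
contains k π R τ = any (isOccurrence k π R (length τ) τ) (incSeqs k 1 (length τ))

sPlus : (k : ℕ) → List ℕ → (ℕ → ℕ → Bool) → ℕ → ℕ
sPlus k π R n = length (filter (λ τ → T? (contains k π R τ)) (perms n))

boxedR : ℕ → ℕ → ℕ → Bool
boxedR k x y = ((1 ≤ᵇ x) ∧ (x ≤ᵇ k ∸ 1)) ∧ ((1 ≤ᵇ y) ∧ (y ≤ᵇ k ∸ 1))

-- A permutation τ ∈ S_n (n ≥ k) whose last k entries are order-isomorphic to π
-- contains p: these k consecutive positions form an occurrence, because every
-- shaded box of p lies in a column between two adjacent positions and so holds
-- no point of τ.  Such permutations are obtained from π by repeatedly prepending
-- a new first value j and shifting all values ≥ j up by one; this produces n!/k!
-- distinct permutations of length n, hence s_n^+(p) · k! ≥ n! for every n ≥ k.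
module Submission where

open import Defs
open import Data.Nat using (ℕ; zero; suc; _*_; _+_; _∸_; _≤_; _<_; _!; z≤n; s≤s; _≡ᵇ_; _<ᵇ_; _≤ᵇ_)
open import Data.Nat.Properties
open import Data.Bool using (Bool; true; false; not; _∧_; _∨_; if_then_else_; T)
open import Data.Bool.Properties using (T-∧; T-≡)
open import Data.Bool.ListAction using (all; any)
open import Data.List using (List; []; _∷_; [_]; map; upTo; length; filter; _++_; cartesianProductWith)
open import Data.List.Properties using (length-map; length-++; length-upTo; ∷-injective; map-injective)
open import Data.List.Membership.Propositional using (_∈_; lose)
open import Data.List.Membership.Propositional.Properties
open import Data.List.Relation.Binary.Subset.Propositional using (_⊆_)
open import Data.List.Relation.Unary.All as All using (All; []; _∷_)
open import Data.List.Relation.Unary.All.Properties using (all⁺; all⁻) renaming (map⁺ to All-map⁺)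
open import Data.List.Relation.Unary.Any using (here; there)
open import Data.List.Relation.Unary.Any.Properties using (any⁺)
open import Data.List.Relation.Unary.AllPairs using ([]; _∷_)
open import Data.List.Relation.Unary.Unique.Propositional using (Unique)
import Data.List.Relation.Unary.Unique.Propositional.Properties as Unique
open import Data.Product using (∃-syntax; _×_; _,_; proj₁)
open import Data.Sum using (inj₁; inj₂)
open import Function using (_∘_; Equivalence)
open import Relation.Binary.Definitions using (tri<; tri≈; tri>)
open import Relation.Binary.PropositionalEquality using (_≡_; _≢_; refl; sym; trans; cong; cong₂; subst; module ≡-Reasoning)
open import Relation.Nullary using (yes; no; contradiction)
open import Relation.Nullary.Decidable using (T?)
open import Relation.Nullary.Reflects using (Reflects; det; fromEquivalence; ofⁿ)

<ᵇ-cong : ∀ {a b c d} → (a < b → c < d) → (c < d → a < b) → (a <ᵇ b) ≡ (c <ᵇ d)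
<ᵇ-cong {a} {b} {c} {d} f g = det (<ᵇ-reflects-< a b) (fromEquivalence (g ∘ <ᵇ⇒< c d) (<⇒<ᵇ ∘ f))

≡ᵇ-reflects-≡ : ∀ a b → Reflects (a ≡ b) (a ≡ᵇ b)
≡ᵇ-reflects-≡ a b = fromEquivalence (≡ᵇ⇒≡ a b) (≡⇒≡ᵇ a b)

≡ᵇ-cong : ∀ {a b c d} → (a ≡ b → c ≡ d) → (c ≡ d → a ≡ b) → (a ≡ᵇ b) ≡ (c ≡ᵇ d)
≡ᵇ-cong {a} {b} {c} {d} f g = det (≡ᵇ-reflects-≡ a b) (fromEquivalence (g ∘ ≡ᵇ⇒≡ c d) (≡⇒≡ᵇ c d ∘ f))

≡ᵇ-false : ∀ {a b} → a ≢ b → (a ≡ᵇ b) ≡ false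
≡ᵇ-false {a} {b} a≢b = det (≡ᵇ-reflects-≡ a b) (ofⁿ a≢b)

<ᵇ-false : ∀ {a b} → b ≤ a → (a <ᵇ b) ≡ false
<ᵇ-false {a} {b} b≤a = det (<ᵇ-reflects-< a b) (ofⁿ (≤⇒≯ b≤a))

T-⇔ᵇ-refl : ∀ b → T (b ⇔ᵇ b)
T-⇔ᵇ-refl true  = _
T-⇔ᵇ-refl false = _

T-not-∨ : ∀ {a b} → (T a → T b) → T (not a ∨ b)
T-not-∨ {true}  a⇒b = a⇒b _
T-not-∨ {false} _   = _

T-allPairs : ∀ xs ys (f : ℕ → ℕ → Bool) → (∀ {x y} → x ∈ xs → y ∈ ys → T (f x y)) → T (allPairs xs ys f)
T-allPairs xs ys f h = all⁻ _ (All.tabulate λ x∈xs → all⁻ _ (All.tabulate λ y∈ys → h x∈xs y∈ys))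

∈-range⁺ : ∀ {a b x} → a ≤ x → x ≤ b → x ∈ range a b
∈-range⁺ {a} {b} {x} a≤x x≤b = subst (_∈ range a b) (m+[n∸m]≡n a≤x) (∈-map⁺ (a +_) (∈-upTo⁺ x∸a<))
  where
  x∸a< : x ∸ a < suc b ∸ a
  x∸a< = subst (x ∸ a <_) (sym (+-∸-assoc 1 (≤-trans a≤x x≤b))) (s≤s (∸-monoˡ-≤ a x≤b))

∈-range⁻ : ∀ {a b x} → x ∈ range a b → a ≤ x × x ≤ b
∈-range⁻ {a} {b} x∈ with ∈-map⁻ (a +_) x∈
... | i , i∈ , refl = m≤m+n a i , a+i≤b
  where
  i< : i < suc b ∸ a
  i< = ∈-upTo⁻ i∈
  a+i≤b : a + i ≤ b
  a+i≤b with a ≤? suc b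
  ... | yes a≤1+b = ≤-pred (subst (_≤ suc b) (trans (+-comm (suc i) a) (+-suc a i)) (m≤o∸n⇒m+n≤o (suc i) a≤1+b i<))
  ... | no a≰1+b = contradiction (subst (i <_) (m≤n⇒m∸n≡0 (<⇒≤ (≰⇒> a≰1+b))) i<) λ ()

length-range : ∀ a b → length (range a b) ≡ suc b ∸ a
length-range a b = trans (length-map (a +_) (upTo (suc b ∸ a))) (length-upTo (suc b ∸ a))

range-unique : ∀ a b → Unique (range a b)
range-unique a b = Unique.map⁺ (+-cancelˡ-≡ a _ _) (Unique.upTo⁺ (suc b ∸ a))

length-cartesianProductWith : ∀ {A B C : Set} (f : A → B → C) xs ys →
  length (cartesianProductWith f xs ys) ≡ length xs * length ys
length-cartesianProductWith f []       ys = refl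
length-cartesianProductWith f (x ∷ xs) ys = begin
  length (map (f x) ys ++ cartesianProductWith f xs ys)    ≡⟨ length-++ (map (f x) ys) ⟩
  length (map (f x) ys) + length (cartesianProductWith f xs ys)
    ≡⟨ cong₂ _+_ (length-map (f x) ys) (length-cartesianProductWith f xs ys) ⟩
  length ys + length xs * length ys                        ∎
  where open ≡-Reasoning

Unique⇒length≤ : ∀ {A : Set} {xs ys : List A} → Unique xs → xs ⊆ ys → length xs ≤ length ys
Unique⇒length≤ {xs = []}     _            _     = z≤n
Unique⇒length≤ {xs = x ∷ xs} (x∉xs ∷ uxs) x∷xs⊆ys with ∈-∃++ (x∷xs⊆ys (here refl))
... | ys₁ , ys₂ , refl = subst (suc (length xs) ≤_) (sym length-ys)
      (s≤s (Unique⇒length≤ uxs (λ z∈xs → drop-x (x∷xs⊆ys (there z∈xs)) (All.lookup x∉xs z∈xs))))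
  where
  drop-x : ∀ {z} → z ∈ ys₁ ++ x ∷ ys₂ → x ≢ z → z ∈ ys₁ ++ ys₂
  drop-x z∈ x≢z with ∈-++⁻ ys₁ z∈
  ... | inj₁ z∈ys₁         = ∈-++⁺ˡ z∈ys₁
  ... | inj₂ (here refl)   = contradiction refl x≢z
  ... | inj₂ (there z∈ys₂) = ∈-++⁺ʳ ys₁ z∈ys₂
  length-ys : length (ys₁ ++ x ∷ ys₂) ≡ suc (length (ys₁ ++ ys₂))
  length-ys rewrite length-++ ys₁ {x ∷ ys₂} | length-++ ys₁ {ys₂} = +-suc (length ys₁) (length ys₂)

∈-words⁺ : ∀ {l n τ} → length τ ≡ l → All (λ x → 1 ≤ x × x ≤ n) τ → τ ∈ words l n
∈-words⁺ {zero}  {τ = []}    refl []                    = here refl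
∈-words⁺ {suc l} {n} {x ∷ τ} refl ((1≤x , x≤n) ∷ bounds) =
  ∈-concatMap⁺ (λ w → map (_∷ w) (range 1 n)) (lose (∈-words⁺ refl bounds) (∈-map⁺ (_∷ τ) (∈-range⁺ 1≤x x≤n)))

isPerm⁻ : ∀ {n τ} → T (isPerm n τ) → length τ ≡ n × All (λ x → 1 ≤ x × x ≤ n) τ × T (distinct τ)
isPerm⁻ {n} {τ} p with Equivalence.to (T-∧ {length τ ≡ᵇ n}) p
... | len , rest with Equivalence.to (T-∧ {all (λ x → (1 ≤ᵇ x) ∧ (x ≤ᵇ n)) τ}) rest
... | bounds , dist = ≡ᵇ⇒≡ _ _ len , All.map bound (all⁺ _ τ bounds) , dist
  where
  bound : ∀ {x} → T ((1 ≤ᵇ x) ∧ (x ≤ᵇ n)) → 1 ≤ x × x ≤ n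
  bound {x} b with Equivalence.to (T-∧ {1 ≤ᵇ x}) b
  ... | 1≤x , x≤n = ≤ᵇ⇒≤ 1 x 1≤x , ≤ᵇ⇒≤ x n x≤n

isPerm⁺ : ∀ {n τ} → length τ ≡ n → All (λ x → 1 ≤ x × x ≤ n) τ → T (distinct τ) → T (isPerm n τ)
isPerm⁺ {n} {τ} len bounds dist = Equivalence.from T-∧
  (≡⇒≡ᵇ _ _ len , Equivalence.from T-∧ (all⁻ _ (All.map bound bounds) , dist))
  where
  bound : ∀ {x} → 1 ≤ x × x ≤ n → T ((1 ≤ᵇ x) ∧ (x ≤ᵇ n))
  bound (1≤x , x≤n) = Equivalence.from T-∧ (≤⇒≤ᵇ 1≤x , ≤⇒≤ᵇ x≤n)

∈-perms⁺ : ∀ {n τ} → T (isPerm n τ) → τ ∈ perms n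
∈-perms⁺ {n} {τ} p with isPerm⁻ {n} {τ} p
... | len , bounds , _ = ∈-filter⁺ (T? ∘ isPerm n) (∈-words⁺ len bounds) p

consecutive : ℕ → ℕ → List ℕ
consecutive lo zero    = []
consecutive lo (suc k) = lo ∷ consecutive (suc lo) k

consecutive-∈-incSeqs : ∀ {k lo lo′ hi} → lo′ ≤ lo → lo + k ≤ suc hi → consecutive lo k ∈ incSeqs k lo′ hi
consecutive-∈-incSeqs {zero}                  _      _        = here refl
consecutive-∈-incSeqs {suc k} {lo} {lo′} {hi} lo′≤lo lo+k<hi =
  ∈-concatMap⁺ (λ i → map (i ∷_) (incSeqs k (suc i) hi))
    (lose (∈-range⁺ lo′≤lo (≤-trans (m≤m+n lo k) lo+k≤hi))
          (∈-map⁺ (lo ∷_) (consecutive-∈-incSeqs ≤-refl (s≤s lo+k≤hi))))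
  where
  lo+k≤hi : lo + k ≤ hi
  lo+k≤hi = ≤-pred (subst (_≤ suc hi) (+-suc lo k) lo+k<hi)

at-consecutive : ∀ {k} lo a → a < k → at (consecutive lo k) (suc a) ≡ lo + a
at-consecutive {suc k} lo zero    _         = sym (+-identityʳ lo)
at-consecutive {suc k} lo (suc a) (s≤s a<k) = trans (at-consecutive (suc lo) a a<k) (sym (+-suc lo a))

punchIn : ℕ → ℕ → ℕ
punchIn j x = if x <ᵇ j then x else suc x

data PunchInView (j x : ℕ) : ℕ → Set where
  below : x < j → PunchInView j x x
  above : j ≤ x → PunchInView j x (suc x)

punchIn-view : ∀ j x → PunchInView j x (punchIn j x)
punchIn-view j x with x <ᵇ j in x<ᵇj
... | true  = below (<ᵇ⇒< x j (Equivalence.from T-≡ x<ᵇj))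
... | false = above (≮⇒≥ (λ x<j → subst T x<ᵇj (<⇒<ᵇ x<j)))

punchIn-mono-≤ : ∀ j {u v} → u ≤ v → punchIn j u ≤ punchIn j v
punchIn-mono-≤ j {u} {v} u≤v with punchIn j u | punchIn-view j u | punchIn j v | punchIn-view j v
... | _ | below _   | _ | below _   = u≤v
... | _ | below _   | _ | above _   = m≤n⇒m≤1+n u≤v
... | _ | above j≤u | _ | below v<j = contradiction (≤-trans j≤u u≤v) (<⇒≱ v<j)
... | _ | above _   | _ | above _   = s≤s u≤v

punchIn-mono-< : ∀ j {u v} → u < v → punchIn j u < punchIn j v
punchIn-mono-< j {u} {v} u<v with punchIn j u | punchIn-view j u | punchIn j v | punchIn-view j v
... | _ | below _   | _ | below _   = u<v
... | _ | below _   | _ | above _   = m<n⇒m<1+n u<v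
... | _ | above j≤u | _ | below v<j = contradiction (≤-trans j≤u (<⇒≤ u<v)) (<⇒≱ v<j)
... | _ | above _   | _ | above _   = s≤s u<v

punchIn-cancel-< : ∀ j {u v} → punchIn j u < punchIn j v → u < v
punchIn-cancel-< j p = ≰⇒> λ v≤u → <⇒≱ p (punchIn-mono-≤ j v≤u)

punchIn-injective : ∀ j {u v} → punchIn j u ≡ punchIn j v → u ≡ v
punchIn-injective j {u} {v} eq with <-cmp u v
... | tri< u<v _ _ = contradiction eq (<⇒≢ (punchIn-mono-< j u<v))
... | tri≈ _ u≡v _ = u≡v
... | tri> _ _ v<u = contradiction (sym eq) (<⇒≢ (punchIn-mono-< j v<u))

punchIn≢ : ∀ j x → j ≢ punchIn j x
punchIn≢ j x with punchIn j x | punchIn-view j x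
... | _ | below x<j = >⇒≢ x<j
... | _ | above j≤x = <⇒≢ (s≤s j≤x)

x≤punchIn : ∀ j x → x ≤ punchIn j x
x≤punchIn j x with punchIn j x | punchIn-view j x
... | _ | below _ = ≤-refl
... | _ | above _ = n≤1+n x

punchIn≤suc : ∀ j x → punchIn j x ≤ suc x
punchIn≤suc j x with punchIn j x | punchIn-view j x
... | _ | below _ = n≤1+n x
... | _ | above _ = ≤-refl

at-map : ∀ (f : ℕ → ℕ) xs {i} → 1 ≤ i → i ≤ length xs → at (map f xs) i ≡ f (at xs i)
at-map f (x ∷ xs) {suc zero}    _ _         = refl
at-map f (x ∷ xs) {suc (suc i)} _ (s≤s i<) = at-map f xs (s≤s z≤n) i<

prepend : ℕ → List ℕ → List ℕ
prepend j τ = j ∷ map (punchIn j) τ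

prepend-injective : ∀ {i j σ τ} → prepend i σ ≡ prepend j τ → i ≡ j × σ ≡ τ
prepend-injective {i} eq with ∷-injective eq
... | refl , eq′ = refl , map-injective (punchIn-injective i) eq′

at-prepend : ∀ j τ {i} → 1 ≤ i → i ≤ length τ → at (prepend j τ) (suc i) ≡ punchIn j (at τ i)
at-prepend j τ {suc i} 1≤i i≤ = at-map (punchIn j) τ 1≤i i≤

any-≡ᵇ-punchIn : ∀ j x xs → any (punchIn j x ≡ᵇ_) (map (punchIn j) xs) ≡ any (x ≡ᵇ_) xs
any-≡ᵇ-punchIn j x []       = refl
any-≡ᵇ-punchIn j x (y ∷ ys) =
  cong₂ _∨_ (≡ᵇ-cong (punchIn-injective j) (cong (punchIn j))) (any-≡ᵇ-punchIn j x ys)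

any-≡ᵇ-punchIn-self : ∀ j xs → any (j ≡ᵇ_) (map (punchIn j) xs) ≡ false
any-≡ᵇ-punchIn-self j []       = refl
any-≡ᵇ-punchIn-self j (x ∷ xs) = cong₂ _∨_ (≡ᵇ-false (punchIn≢ j x)) (any-≡ᵇ-punchIn-self j xs)

distinct-map-punchIn : ∀ j xs → distinct (map (punchIn j) xs) ≡ distinct xs
distinct-map-punchIn j []       = refl
distinct-map-punchIn j (x ∷ xs) =
  cong₂ (λ b c → not b ∧ c) (any-≡ᵇ-punchIn j x xs) (distinct-map-punchIn j xs)

distinct-prepend : ∀ j τ → T (distinct τ) → T (distinct (prepend j τ))
distinct-prepend j τ rewrite any-≡ᵇ-punchIn-self j τ | distinct-map-punchIn j τ = λ d → d

isPerm-prepend : ∀ {n j τ} → 1 ≤ j → j ≤ suc n → T (isPerm n τ) → T (isPerm (suc n) (prepend j τ))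
isPerm-prepend {n} {j} {τ} 1≤j j≤1+n τ∈Sₙ with isPerm⁻ {n} {τ} τ∈Sₙ
... | len , bounds , dist = isPerm⁺ (cong suc (trans (length-map (punchIn j) τ) len))
  ((1≤j , j≤1+n) ∷ All-map⁺ (All.map bound bounds)) (distinct-prepend j τ dist)
  where
  bound : ∀ {x} → 1 ≤ x × x ≤ n → 1 ≤ punchIn j x × punchIn j x ≤ suc n
  bound {x} (1≤x , x≤n) = ≤-trans 1≤x (x≤punchIn j x) , ≤-trans (punchIn≤suc j x) (s≤s x≤n)

punchIn-<ᵇ : ∀ j u v → (punchIn j u <ᵇ punchIn j v) ≡ (u <ᵇ v)
punchIn-<ᵇ j u v = <ᵇ-cong (punchIn-cancel-< j) (punchIn-mono-< j)

no-point-between-adjacent : ∀ {lo hi} (Z : ℕ → Bool) ms → hi ≡ suc lo →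
  T (not (any (λ m → ((lo <ᵇ m) ∧ (m <ᵇ hi)) ∧ Z m) ms))
no-point-between-adjacent      Z []       _    = _
no-point-between-adjacent {lo} Z (m ∷ ms) refl with lo <ᵇ m in lo<ᵇm
... | false = no-point-between-adjacent Z ms refl
... | true rewrite <ᵇ-false (<ᵇ⇒< lo m (Equivalence.from T-≡ lo<ᵇm)) = no-point-between-adjacent Z ms refl

shaded⇒interior : ∀ k {x y} → T (boxedR k x y) → 1 ≤ x × suc x ≤ k
shaded⇒interior zero    {x} {y} shaded with Equivalence.to (T-∧ {(1 ≤ᵇ x) ∧ (x ≤ᵇ 0)}) shaded
... | x-interior , _ with Equivalence.to (T-∧ {1 ≤ᵇ x}) x-interior
... | 1≤x , x≤0 = contradiction (≤-trans (≤ᵇ⇒≤ 1 x 1≤x) (≤ᵇ⇒≤ x 0 x≤0)) λ ()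
shaded⇒interior (suc k) {x} {y} shaded with Equivalence.to (T-∧ {(1 ≤ᵇ x) ∧ (x ≤ᵇ k)}) shaded
... | x-interior , _ with Equivalence.to (T-∧ {1 ≤ᵇ x}) x-interior
... | 1≤x , x≤k = ≤ᵇ⇒≤ 1 x 1≤x , s≤s (≤ᵇ⇒≤ x k x≤k)

shaded-columns-adjacent⇒empty : ∀ xs ys (R : ℕ → ℕ → Bool) (col : ℕ → ℕ) (Z : ℕ → ℕ → Bool) ms →
  (∀ {x y} → T (R x y) → col (suc x) ≡ suc (col x)) →
  T (allPairs xs ys (λ x y → not (R x y) ∨ not (any (λ m → ((col x <ᵇ m) ∧ (m <ᵇ col (suc x))) ∧ Z y m) ms)))
shaded-columns-adjacent⇒empty xs ys R col Z ms adjacent =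
  T-allPairs xs ys (λ x y → not (R x y) ∨ not (any (λ m → ((col x <ᵇ m) ∧ (m <ᵇ col (suc x))) ∧ Z y m) ms))
    λ _ _ → T-not-∨ λ shaded → no-point-between-adjacent (Z _) ms (adjacent shaded)

module _ (k : ℕ) (π : List ℕ) where

  EndsInPattern : ℕ → List ℕ → Set
  EndsInPattern n τ = ∀ {a b} → 1 ≤ a → a ≤ k → 1 ≤ b → b ≤ k →
    (at τ (n ∸ k + a) <ᵇ at τ (n ∸ k + b)) ≡ (at π a <ᵇ at π b)

  pattern-endsInPattern : EndsInPattern k π
  pattern-endsInPattern {a} {b} _ _ _ _ rewrite n∸n≡0 k = refl

  at-prepend-suffix : ∀ {n j τ a} → k ≤ n → length τ ≡ n → 1 ≤ a → a ≤ k →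
    at (prepend j τ) (suc n ∸ k + a) ≡ punchIn j (at τ (n ∸ k + a))
  at-prepend-suffix {n} {j} {τ} {a} k≤n len 1≤a a≤k = begin
    at (prepend j τ) (suc n ∸ k + a)    ≡⟨ cong (λ i → at (prepend j τ) (i + a)) (+-∸-assoc 1 k≤n) ⟩
    at (prepend j τ) (suc (n ∸ k + a))  ≡⟨ at-prepend j τ (≤-trans 1≤a (m≤n+m a (n ∸ k))) n∸k+a≤length ⟩
    punchIn j (at τ (n ∸ k + a))        ∎
    where
    open ≡-Reasoning
    n∸k+a≤length : n ∸ k + a ≤ length τ
    n∸k+a≤length = ≤-trans (+-monoʳ-≤ (n ∸ k) a≤k) (≤-reflexive (trans (m∸n+n≡m k≤n) (sym len)))

  prepend-endsInPattern : ∀ {n j τ} → k ≤ n → length τ ≡ n → EndsInPattern n τ → EndsInPattern (suc n) (prepend j τ)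
  prepend-endsInPattern {n} {j} {τ} k≤n len ends {a} {b} 1≤a a≤k 1≤b b≤k = begin
    (at (prepend j τ) (suc n ∸ k + a) <ᵇ at (prepend j τ) (suc n ∸ k + b))
      ≡⟨ cong₂ _<ᵇ_ (at-prepend-suffix k≤n len 1≤a a≤k) (at-prepend-suffix k≤n len 1≤b b≤k) ⟩
    (punchIn j (at τ (n ∸ k + a)) <ᵇ punchIn j (at τ (n ∸ k + b)))
      ≡⟨ punchIn-<ᵇ j _ _ ⟩
    (at τ (n ∸ k + a) <ᵇ at τ (n ∸ k + b))
      ≡⟨ ends 1≤a a≤k 1≤b b≤k ⟩
    (at π a <ᵇ at π b) ∎
    where open ≡-Reasoning

  suffixPositions : ℕ → List ℕ
  suffixPositions n = consecutive (suc (n ∸ k)) k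

  at-suffixPositions : ∀ n {a} → 1 ≤ a → a ≤ k → at (suffixPositions n) a ≡ n ∸ k + a
  at-suffixPositions n {suc a} _ a<k = trans (at-consecutive (suc (n ∸ k)) a a<k) (sym (+-suc (n ∸ k) a))

  -- the position i_x of Defs.isOccurrence, with i_0 = 0 and i_{k+1} = n + 1
  column : ℕ → List ℕ → ℕ → ℕ
  column n is x = if x ≡ᵇ 0 then 0 else (if k <ᵇ x then suc n else at is x)

  column-interior : ∀ n is {x} → 1 ≤ x → x ≤ k → column n is x ≡ at is x
  column-interior n is {suc x} _ x<k rewrite <ᵇ-false x<k = refl

  suffix-columns-adjacent : ∀ n {x} → 1 ≤ x → suc x ≤ k →
    column n (suffixPositions n) (suc x) ≡ suc (column n (suffixPositions n) x)
  suffix-columns-adjacent n {x} 1≤x x<k = begin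
    column n (suffixPositions n) (suc x)  ≡⟨ column-interior n (suffixPositions n) (s≤s z≤n) x<k ⟩
    at (suffixPositions n) (suc x)        ≡⟨ at-suffixPositions n (s≤s z≤n) x<k ⟩
    n ∸ k + suc x                         ≡⟨ +-suc (n ∸ k) x ⟩
    suc (n ∸ k + x)                       ≡⟨ cong suc (at-suffixPositions n 1≤x (<⇒≤ x<k)) ⟨
    suc (at (suffixPositions n) x)        ≡⟨ cong suc (column-interior n (suffixPositions n) 1≤x (<⇒≤ x<k)) ⟨
    suc (column n (suffixPositions n) x)  ∎
    where open ≡-Reasoning

  suffix-isOccurrence : ∀ {n τ} → EndsInPattern n τ → T (isOccurrence k π (boxedR k) n τ (suffixPositions n))
  suffix-isOccurrence {n} {τ} ends = Equivalence.from (T-∧ {allPairs (range 1 k) (range 1 k) orderedᵇ})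
    ( T-allPairs (range 1 k) (range 1 k) orderedᵇ (λ a∈ b∈ → ordered (∈-range⁻ a∈) (∈-range⁻ b∈))
    , shaded-columns-adjacent⇒empty (range 0 k) (range 0 k) (boxedR k) (column n (suffixPositions n)) _ (range 1 n)
        λ {x} {y} shaded → let 1≤x , x<k = shaded⇒interior k {x} {y} shaded in suffix-columns-adjacent n 1≤x x<k)
    where
    orderedᵇ : ℕ → ℕ → Bool
    orderedᵇ a b = (at τ (at (suffixPositions n) a) <ᵇ at τ (at (suffixPositions n) b)) ⇔ᵇ (at π a <ᵇ at π b)
    ordered : ∀ {a b} → 1 ≤ a × a ≤ k → 1 ≤ b × b ≤ k → T (orderedᵇ a b)
    ordered {a} {b} (1≤a , a≤k) (1≤b , b≤k)
      rewrite at-suffixPositions n 1≤a a≤k | at-suffixPositions n 1≤b b≤k | ends 1≤a a≤k 1≤b b≤k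
      = T-⇔ᵇ-refl (at π a <ᵇ at π b)

  suffix-contains : ∀ {n τ} → k ≤ n → length τ ≡ n → EndsInPattern n τ → T (contains k π (boxedR k) τ)
  suffix-contains {n} {τ} k≤n refl ends = any⁺ (isOccurrence k π (boxedR k) n τ)
    (lose (consecutive-∈-incSeqs {k} {suc (n ∸ k)} (s≤s z≤n) (≤-reflexive (cong suc (m∸n+n≡m k≤n))))
          (suffix-isOccurrence {length τ} {τ} ends))

  extensions : ℕ → List (List ℕ)
  extensions zero    = [ π ]
  extensions (suc d) = cartesianProductWith prepend (range 1 (suc (d + k))) (extensions d)

  extensions-sound : T (isPerm k π) → ∀ d {τ} → τ ∈ extensions d → T (isPerm (d + k) τ) × EndsInPattern (d + k) τ
  extensions-sound π∈Sₖ zero    (here refl) = π∈Sₖ , pattern-endsInPattern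
  extensions-sound π∈Sₖ (suc d) τ∈ with ∈-cartesianProductWith⁻ prepend (range 1 (suc (d + k))) (extensions d) τ∈
  ... | j , σ , j∈ , σ∈ , refl with ∈-range⁻ j∈ | extensions-sound π∈Sₖ d σ∈
  ...   | 1≤j , j≤ | σ∈Sₙ , σ-ends =
    isPerm-prepend {d + k} {j} {σ} 1≤j j≤ σ∈Sₙ , prepend-endsInPattern (m≤n+m k d) (proj₁ (isPerm⁻ {d + k} {σ} σ∈Sₙ)) σ-ends

  extensions-unique : ∀ d → Unique (extensions d)
  extensions-unique zero    = [] ∷ []
  extensions-unique (suc d) =
    Unique.cartesianProductWith⁺ prepend prepend-injective (range-unique 1 (suc (d + k))) (extensions-unique d)

  length-extensions : ∀ d → length (extensions d) * k ! ≡ (d + k) !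
  length-extensions zero    = +-identityʳ (k !)
  length-extensions (suc d) = begin
    length (extensions (suc d)) * k !
      ≡⟨ cong (_* k !) (length-cartesianProductWith prepend (range 1 (suc (d + k))) (extensions d)) ⟩
    length (range 1 (suc (d + k))) * length (extensions d) * k !
      ≡⟨ cong (λ l → l * length (extensions d) * k !) (length-range 1 (suc (d + k))) ⟩
    suc (d + k) * length (extensions d) * k !
      ≡⟨ *-assoc (suc (d + k)) (length (extensions d)) (k !) ⟩
    suc (d + k) * (length (extensions d) * k !)
      ≡⟨ cong (suc (d + k) *_) (length-extensions d) ⟩
    suc (d + k) !                                         ∎
    where open ≡-Reasoning

  extensions⊆containing : T (isPerm k π) → ∀ d → extensions d ⊆ filter (T? ∘ contains k π (boxedR k)) (perms (d + k))
  extensions⊆containing π∈Sₖ d {τ} τ∈ with extensions-sound π∈Sₖ d τ∈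
  ... | τ∈Sₙ , ends = ∈-filter⁺ (T? ∘ contains k π (boxedR k)) (∈-perms⁺ τ∈Sₙ)
    (suffix-contains {d + k} {τ} (m≤n+m k d) (proj₁ (isPerm⁻ {d + k} {τ} τ∈Sₙ)) ends)

  [d+k]!≤sPlus*k! : T (isPerm k π) → ∀ d → (d + k) ! ≤ sPlus k π (boxedR k) (d + k) * k !
  [d+k]!≤sPlus*k! π∈Sₖ d = begin
    (d + k) !                               ≡⟨ length-extensions d ⟨
    length (extensions d) * k !             ≤⟨ *-monoˡ-≤ (k !) extensions≤sPlus ⟩
    sPlus k π (boxedR k) (d + k) * k !      ∎
    where
    open ≤-Reasoning
    extensions≤sPlus : length (extensions d) ≤ sPlus k π (boxedR k) (d + k)
    extensions≤sPlus = Unique⇒length≤ (extensions-unique d) (extensions⊆containing π∈Sₖ d)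

  n!≤sPlus*k! : T (isPerm k π) → ∀ n → k ≤ n → n ! ≤ sPlus k π (boxedR k) n * k !
  n!≤sPlus*k! π∈Sₖ n k≤n =
    subst (λ n → n ! ≤ sPlus k π (boxedR k) n * k !) (m∸n+n≡m k≤n) ([d+k]!≤sPlus*k! π∈Sₖ (n ∸ k))

corollary3p4 : (k : ℕ) → 1 ≤ k → (π : List ℕ) → T (isPerm k π) →
    (m : ℕ) → 1 ≤ m → ∃[ N ] ((n : ℕ) → N ≤ n →
      (n !) * m ≤ sPlus k π (boxedR k) n * (k !) * m + (n !) * (k !))
corollary3p4 k _ π π∈Sₖ m _ = k , λ n k≤n →
  ≤-trans (*-monoˡ-≤ m (n!≤sPlus*k! k π π∈Sₖ n k≤n)) (m≤m+n _ _)
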